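{- Let $p$ be a prime and $2\leq d\leq p$. Then $\omega_1(p^d)=pd$.
   Context: An integer polynomial $f$ is a null polynomial modulo $m$ if $f(x)\equiv 0\pmod m$ for every integer $x$; a monic null polynomial of degree $n$ modulo $m$ is one coefficientwise congruent modulo $m$ to a monic polynomial of degree $n$. $\omega_1(m)$ is the least integer $n\geq 1$ for which a monic null polynomial of degree $n$ modulo $m$ exists. -}

module Defs where

open import Data.Nat using (ℕ; zero; suc; _≤_)
open import Data.Integer using (ℤ; +_; _+_; _*_; _-_)
open import Data.Integer.Divisibility using (_∣_)
open import Data.List using (List; []; _∷_; _++_; [_]; length)
open import Data.Product using (Σ; _×_; ∃)
open import Relation.Binary.PropositionalEquality using (_≡_)

-- Integer polynomials as coefficient lists, lowest degree first.
Poly : Set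
Poly = List ℤ

eval : Poly → ℤ → ℤ
eval []       x = + 0
eval (c ∷ cs) x = c + x * eval cs x

coeff : Poly → ℕ → ℤ
coeff []       i       = + 0
coeff (c ∷ cs) zero    = c
coeff (c ∷ cs) (suc i) = coeff cs i

_≡[mod_]_ : ℤ → ℕ → ℤ → Set
a ≡[mod m ] b = (+ m) ∣ (a - b)

IsNull : ℕ → Poly → Set
IsNull m f = ∀ (x : ℤ) → (+ m) ∣ eval f x

IsMonicOfDegree : ℕ → Poly → Set
IsMonicOfDegree n g = Σ Poly λ cs → (length cs ≡ n) × (g ≡ cs ++ [ + 1 ])

IsMonicModOfDegree : ℕ → ℕ → Poly → Set
IsMonicModOfDegree m n f =
  Σ Poly λ g → IsMonicOfDegree n g × (∀ (i : ℕ) → coeff f i ≡[mod m ] coeff g i)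

HasMonicNull : ℕ → ℕ → Set
HasMonicNull m n = Σ Poly λ f → IsNull m f × IsMonicModOfDegree m n f

ω₁≡ : ℕ → ℕ → Set
ω₁≡ m k = (1 ≤ k) × HasMonicNull m k × (∀ (n : ℕ) → 1 ≤ n → HasMonicNull m n → k ≤ n)

module Submission where

-- If f is monic of degree n and null modulo M, then so is every coefficientwise congruent
-- polynomial, and M divides its n-th finite difference, which is the constant n!.  For n < p²
-- the exact power of p dividing n! is p^⌊n/p⌋, because each multiple q·p with q < p contributes
-- a single factor p; hence p^d ∤ n! whenever n < pd and d ≤ p, so ω₁(p^d) ≥ pd.  Conversely
-- (x(x-1)⋯(x-p+1))^d is monic of degree pd, and each factor is a product of p consecutive
-- integers, hence divisible by p.

open import Defs
open import Data.Nat.Base using (ℕ; zero; suc; _!; NonZero; NonTrivial)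
import Data.Nat.Base as ℕ
import Data.Nat.Divisibility as ℕ
import Data.Nat.Properties as ℕ
open import Data.List using (List; []; _∷_; _++_; [_]; length; applyDownFrom)
open import Data.List.Properties using (length-++; length-applyDownFrom)
open import Data.List.Relation.Unary.Any using (Any; here; there)
import Data.List.Relation.Unary.Any.Properties as Any
open import Data.Product using (_,_)
open import Function using (_∘_)
open import Relation.Binary.PropositionalEquality
  using (_≡_; refl; sym; trans; cong; cong₂; subst; subst₂; module ≡-Reasoning)

module FiniteDifferences where
  open import Data.Integer using (ℤ; +_; 0ℤ; 1ℤ; _+_; _-_; _*_)
  import Data.Integer.Properties as ℤ
  open import Data.Integer.Divisibility.Signed using (_∣_; ∣m∣n⇒∣m-n)
  open import Data.Integer.Tactic.RingSolver using (solve-∀)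
  open ≡-Reasoning

  Δ : (ℤ → ℤ) → ℤ → ℤ
  Δ h x = h (x + 1ℤ) - h x

  Δ^ : ℕ → (ℤ → ℤ) → ℤ → ℤ
  Δ^ zero    h = h
  Δ^ (suc m) h = Δ (Δ^ m h)

  Δ^-+ : ∀ m (h k : ℤ → ℤ) x → Δ^ m (λ y → h y + k y) x ≡ Δ^ m h x + Δ^ m k x
  Δ^-+ zero    h k x = refl
  Δ^-+ (suc m) h k x = begin
      Δ^ m (λ y → h y + k y) (x + 1ℤ) - Δ^ m (λ y → h y + k y) x
    ≡⟨ cong₂ _-_ (Δ^-+ m h k (x + 1ℤ)) (Δ^-+ m h k x) ⟩
      (Δ^ m h (x + 1ℤ) + Δ^ m k (x + 1ℤ)) - (Δ^ m h x + Δ^ m k x)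
    ≡⟨ interchange (Δ^ m h (x + 1ℤ)) (Δ^ m k (x + 1ℤ)) (Δ^ m h x) (Δ^ m k x) ⟩
      Δ^ (suc m) h x + Δ^ (suc m) k x
    ∎
    where
    interchange : ∀ a b c d → (a + b) - (c + d) ≡ (a - c) + (b - d)
    interchange = solve-∀

  Δ^-const : ∀ m c x → Δ^ (suc m) (λ _ → c) x ≡ 0ℤ
  Δ^-const zero    c x = ℤ.+-inverseʳ c
  Δ^-const (suc m) c x = cong₂ _-_ (Δ^-const m c (x + 1ℤ)) (Δ^-const m c x)

  Δ^-leibniz : ∀ m h x →
           Δ^ (suc m) (λ y → y * h y) x ≡ x * Δ^ (suc m) h x + + suc m * Δ^ m h (x + 1ℤ)
  Δ^-leibniz zero    h x = leibniz x (h (x + 1ℤ)) (h x)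
    where
    leibniz : ∀ x a b → (x + 1ℤ) * a - x * b ≡ x * (a - b) + 1ℤ * a
    leibniz = solve-∀
  Δ^-leibniz (suc m) h x = begin
      Δ^ (suc m) (λ y → y * h y) (x + 1ℤ) - Δ^ (suc m) (λ y → y * h y) x
    ≡⟨ cong₂ _-_ (Δ^-leibniz m h (x + 1ℤ)) (Δ^-leibniz m h x) ⟩
      ((x + 1ℤ) * (E₂ - E₁) + + suc m * E₂) - (x * D + + suc m * E₁)
    ≡⟨ leibniz x D E₂ E₁ (+ suc m) ⟩
      x * ((E₂ - E₁) - D) + (1ℤ + + suc m) * (E₂ - E₁)
    ∎
    where
    D  = Δ^ (suc m) h x
    E₁ = Δ^ m h (x + 1ℤ)
    E₂ = Δ^ m h ((x + 1ℤ) + 1ℤ)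
    leibniz : ∀ x D E₂ E₁ s → ((x + 1ℤ) * (E₂ - E₁) + s * E₂) - (x * D + s * E₁)
                              ≡ x * ((E₂ - E₁) - D) + (1ℤ + s) * (E₂ - E₁)
    leibniz = solve-∀

  Δ^-pres-∣ : ∀ m {M} h → (∀ y → M ∣ h y) → ∀ x → M ∣ Δ^ m h x
  Δ^-pres-∣ zero    h M∣h x = M∣h x
  Δ^-pres-∣ (suc m) h M∣h x = ∣m∣n⇒∣m-n (Δ^-pres-∣ m h M∣h (x + 1ℤ)) (Δ^-pres-∣ m h M∣h x)

module Polynomials where
  open import Data.Integer using (ℤ; +_; -_; 0ℤ; 1ℤ; _+_; _-_; _*_)
  import Data.Integer.Properties as ℤ
  open import Data.Integer.DivMod using (_/ℕ_; _%ℕ_; a≡a%ℕn+[a/ℕn]*n; n%ℕd<d)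
  open import Data.Integer.Divisibility.Signed
    using (_∣_; divides; ∣-refl; ∣-trans; ∣m∣n⇒∣m+n; ∣m+n∣m⇒∣n; ∣m⇒∣-m;
           ∣m⇒∣m*n; ∣n⇒∣m*n; *-monoˡ-∣; *-monoʳ-∣; ∣⇒∣ᵤ; ∣ᵤ⇒∣)
  open import Data.Integer.Tactic.RingSolver using (solve-∀)
  open FiniteDifferences
  open ≡-Reasoning

  eval-[1] : ∀ x → eval [ 1ℤ ] x ≡ 1ℤ
  eval-[1] x = cong (λ t → 1ℤ + t) (ℤ.*-zeroʳ x)

  eval-∷-∣ : ∀ {M} c d cs ds x → M ∣ c - d → M ∣ eval cs x - eval ds x →
             M ∣ eval (c ∷ cs) x - eval (d ∷ ds) x
  eval-∷-∣ {M} c d cs ds x c≈d cs≈ds =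
    subst (M ∣_) (sym (regroup x c d (eval cs x) (eval ds x))) (∣m∣n⇒∣m+n c≈d (∣n⇒∣m*n x cs≈ds))
    where
    regroup : ∀ x a b A B → (a + x * A) - (b + x * B) ≡ (a - b) + x * (A - B)
    regroup = solve-∀

  eval-≡mod : ∀ {M} f g → (∀ i → M ∣ coeff f i - coeff g i) → ∀ x → M ∣ eval f x - eval g x
  eval-≡mod []       []       f≈g x = f≈g 0
  eval-≡mod {M} []       (d ∷ ds) f≈g x =
    subst (λ t → M ∣ t - eval (d ∷ ds) x) (cong (λ t → 0ℤ + t) (ℤ.*-zeroʳ x))
      (eval-∷-∣ 0ℤ d [] ds x (f≈g 0) (eval-≡mod [] ds (f≈g ∘ suc) x))
  eval-≡mod {M} (c ∷ cs) []       f≈g x =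
    subst (λ t → M ∣ eval (c ∷ cs) x - t) (cong (λ t → 0ℤ + t) (ℤ.*-zeroʳ x))
      (eval-∷-∣ c 0ℤ cs [] x (f≈g 0) (eval-≡mod cs [] (f≈g ∘ suc) x))
  eval-≡mod (c ∷ cs) (d ∷ ds) f≈g x =
    eval-∷-∣ c d cs ds x (f≈g 0) (eval-≡mod cs ds (f≈g ∘ suc) x)

  Δ^-eval-monic : ∀ cs x → Δ^ (length cs) (eval (cs ++ [ 1ℤ ])) x ≡ + (length cs !)
  Δ^-eval-monic []       x = eval-[1] x
  Δ^-eval-monic (c ∷ cs) x = begin
      Δ^ (suc k) (λ y → c + y * P y) x
    ≡⟨ Δ^-+ (suc k) (λ _ → c) (λ y → y * P y) x ⟩
      Δ^ (suc k) (λ _ → c) x + Δ^ (suc k) (λ y → y * P y) x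
    ≡⟨ cong₂ _+_ (Δ^-const k c x) (Δ^-leibniz k P x) ⟩
      0ℤ + (x * (Δ^ k P (x + 1ℤ) - Δ^ k P x) + + suc k * Δ^ k P (x + 1ℤ))
    ≡⟨ cong₂ (λ a b → 0ℤ + (x * (a - b) + + suc k * a))
             (Δ^-eval-monic cs (x + 1ℤ)) (Δ^-eval-monic cs x) ⟩
      0ℤ + (x * (+ (k !) - + (k !)) + + suc k * + (k !))
    ≡⟨ cancel x (+ (k !)) (+ suc k) ⟩
      + suc k * + (k !)
    ≡⟨ ℤ.pos-* (suc k) (k !) ⟨
      + (suc k !)
    ∎
    where
    k = length cs
    P = eval (cs ++ [ 1ℤ ])
    cancel : ∀ x a s → 0ℤ + (x * (a - a) + s * a) ≡ s * a
    cancel = solve-∀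

  monicNull⇒∣! : ∀ {M n} → HasMonicNull M n → M ℕ.∣ n !
  monicNull⇒∣! {M} (f , f-null , g , (cs , refl , refl) , f≈g) =
    ∣⇒∣ᵤ (subst (+ M ∣_) (Δ^-eval-monic cs 0ℤ) (Δ^-pres-∣ (length cs) (eval g) g-null 0ℤ))
    where
    g-null : ∀ y → + M ∣ eval g y
    g-null y = subst (+ M ∣_) (ℤ.neg-involutive (eval g y))
      (∣m⇒∣-m (∣m+n∣m⇒∣n {m = eval f y} (eval-≡mod f g (∣ᵤ⇒∣ ∘ f≈g) y) (∣ᵤ⇒∣ (f-null y))))

  addConst : ℤ → Poly → Poly
  addConst c []       = [ c ]
  addConst c (d ∷ ds) = c + d ∷ ds

  mulLinear : ℤ → Poly → Poly
  mulLinear r []       = []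
  mulLinear r (c ∷ cs) = - r * c ∷ addConst c (mulLinear r cs)

  eval-addConst : ∀ c P x → eval (addConst c P) x ≡ c + eval P x
  eval-addConst c []       x = cong (λ t → c + t) (ℤ.*-zeroʳ x)
  eval-addConst c (d ∷ ds) x = ℤ.+-assoc c d (x * eval ds x)

  eval-mulLinear : ∀ r P x → eval (mulLinear r P) x ≡ (x - r) * eval P x
  eval-mulLinear r []       x = sym (ℤ.*-zeroʳ (x - r))
  eval-mulLinear r (c ∷ cs) x = begin
      - r * c + x * eval (addConst c (mulLinear r cs)) x
    ≡⟨ cong (λ t → - r * c + x * t) (eval-addConst c (mulLinear r cs) x) ⟩
      - r * c + x * (c + eval (mulLinear r cs) x)
    ≡⟨ cong (λ t → - r * c + x * (c + t)) (eval-mulLinear r cs x) ⟩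
      - r * c + x * (c + (x - r) * eval cs x)
    ≡⟨ expand x r c (eval cs x) ⟩
      (x - r) * (c + x * eval cs x)
    ∎
    where
    expand : ∀ x r c Q → - r * c + x * (c + (x - r) * Q) ≡ (x - r) * (c + x * Q)
    expand = solve-∀

  mulLinear-monic : ∀ r {n P} → IsMonicOfDegree n P → IsMonicOfDegree (suc n) (mulLinear r P)
  mulLinear-monic r ([] , refl , refl) = [ - r * 1ℤ ] , refl , refl
  mulLinear-monic r (c ∷ cs , refl , refl) with mulLinear-monic r (cs , refl , refl)
  ... | []     , ()  , _
  ... | d ∷ ds , len , eq rewrite eq = - r * c ∷ c + d ∷ ds , cong suc len , refl

  fromRoots : List ℤ → Poly
  fromRoots []       = [ 1ℤ ]
  fromRoots (r ∷ rs) = mulLinear r (fromRoots rs)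

  fromRoots-monic : ∀ rs → IsMonicOfDegree (length rs) (fromRoots rs)
  fromRoots-monic []       = [] , refl , refl
  fromRoots-monic (r ∷ rs) = mulLinear-monic r (fromRoots-monic rs)

  eval-fromRoots-++ : ∀ rs ss x →
                      eval (fromRoots (rs ++ ss)) x ≡ eval (fromRoots rs) x * eval (fromRoots ss) x
  eval-fromRoots-++ []       ss x = sym (trans (cong (_* eval (fromRoots ss) x) (eval-[1] x))
                                               (ℤ.*-identityˡ (eval (fromRoots ss) x)))
  eval-fromRoots-++ (r ∷ rs) ss x = begin
      eval (mulLinear r (fromRoots (rs ++ ss))) x
    ≡⟨ eval-mulLinear r (fromRoots (rs ++ ss)) x ⟩
      (x - r) * eval (fromRoots (rs ++ ss)) x
    ≡⟨ cong ((x - r) *_) (eval-fromRoots-++ rs ss x) ⟩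
      (x - r) * (eval (fromRoots rs) x * eval (fromRoots ss) x)
    ≡⟨ ℤ.*-assoc (x - r) (eval (fromRoots rs) x) (eval (fromRoots ss) x) ⟨
      (x - r) * eval (fromRoots rs) x * eval (fromRoots ss) x
    ≡⟨ cong (_* eval (fromRoots ss) x) (eval-mulLinear r (fromRoots rs) x) ⟨
      eval (fromRoots (r ∷ rs)) x * eval (fromRoots ss) x
    ∎

  fromRoots-∣ : ∀ {M} rs x → Any (λ r → M ∣ x - r) rs → M ∣ eval (fromRoots rs) x
  fromRoots-∣ {M} (r ∷ rs) x M∣x-r =
    subst (M ∣_) (sym (eval-mulLinear r (fromRoots rs) x)) (factor M∣x-r)
    where
    factor : Any (λ r → M ∣ x - r) (r ∷ rs) → M ∣ (x - r) * eval (fromRoots rs) x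
    factor (here  M∣x-r)  = ∣m⇒∣m*n (eval (fromRoots rs) x) M∣x-r
    factor (there M∣x-rs) = ∣n⇒∣m*n (x - r) (fromRoots-∣ rs x M∣x-rs)

  residues : ℕ → List ℤ
  residues m = applyDownFrom +_ m

  m∣x-x%ℕm : ∀ m .{{_ : NonZero m}} x → + m ∣ x - + (x %ℕ m)
  m∣x-x%ℕm m x = divides (x /ℕ m) (begin
      x - + (x %ℕ m)
    ≡⟨ cong (_- + (x %ℕ m)) (a≡a%ℕn+[a/ℕn]*n x m) ⟩
      + (x %ℕ m) + (x /ℕ m) * + m - + (x %ℕ m)
    ≡⟨ cancel (+ (x %ℕ m)) ((x /ℕ m) * + m) ⟩
      (x /ℕ m) * + m
    ∎)
    where
    cancel : ∀ r Q → r + Q - r ≡ Q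
    cancel = solve-∀

  residues-null : ∀ m .{{_ : NonZero m}} x → + m ∣ eval (fromRoots (residues m)) x
  residues-null m x =
    fromRoots-∣ (residues m) x (Any.applyDownFrom⁺ +_ (m∣x-x%ℕm m x) (n%ℕd<d x m))

  repeatedResidues : ℕ → ℕ → List ℤ
  repeatedResidues m zero    = []
  repeatedResidues m (suc d) = residues m ++ repeatedResidues m d

  length-repeatedResidues : ∀ m d → length (repeatedResidues m d) ≡ d ℕ.* m
  length-repeatedResidues m zero    = refl
  length-repeatedResidues m (suc d) =
    trans (length-++ (residues m))
          (cong₂ ℕ._+_ (length-applyDownFrom +_ m) (length-repeatedResidues m d))

  repeatedResidues-null : ∀ m .{{_ : NonZero m}} d x →
                          + (m ℕ.^ d) ∣ eval (fromRoots (repeatedResidues m d)) x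
  repeatedResidues-null m zero    x = subst (+ 1 ∣_) (sym (eval-[1] x)) ∣-refl
  repeatedResidues-null m (suc d) x =
    subst₂ _∣_ (sym (ℤ.pos-* m (m ℕ.^ d)))
               (sym (eval-fromRoots-++ (residues m) (repeatedResidues m d) x))
      (∣-trans (*-monoˡ-∣ (+ (m ℕ.^ d)) (residues-null m x))
               (*-monoʳ-∣ (eval (fromRoots (residues m)) x) (repeatedResidues-null m d x)))

  repeatedResidues-monicNull : ∀ m .{{_ : NonZero m}} d → HasMonicNull (m ℕ.^ d) (m ℕ.* d)
  repeatedResidues-monicNull m d = f , f-null , f , f-monic , λ i → ≡mod-refl (coeff f i)
    where
    f = fromRoots (repeatedResidues m d)
    f-null : IsNull (m ℕ.^ d) f
    f-null x = ∣⇒∣ᵤ (repeatedResidues-null m d x)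
    f-monic : IsMonicOfDegree (m ℕ.* d) f
    f-monic = subst (λ n → IsMonicOfDegree n f)
                    (trans (length-repeatedResidues m d) (ℕ.*-comm d m))
                    (fromRoots-monic (repeatedResidues m d))
    ≡mod-refl : ∀ a → a ≡[mod m ℕ.^ d ] a
    ≡mod-refl a = ∣⇒∣ᵤ {k = + (m ℕ.^ d)} (divides 0ℤ (ℤ.+-inverseʳ a))

open import Data.Nat using (_≤_; _*_; _^_)
open import Data.Nat.Base using (_<_; z≤n; s≤s; s≤s⁻¹; >-nonZero⁻¹; nonTrivial⇒n>1)
open import Data.Nat.Properties
  using (<⇒≱; ≤-reflexive; ≤-trans; <-≤-trans; ≤-<-trans; n≤1+n; <⇒≤; m<n+m; ≮⇒≥;
         m≤n⇒m<n∨m≡n; m≤n⇒∃[o]m+o≡n; *-comm; *-commutativeSemigroup; *-mono-≤; *-monoʳ-≤;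
         *-cancelʳ-<; ^-distribˡ-+-*; m^n≢0)
open import Data.Nat.Divisibility using (_∣_; _∤_; divides; ∣-trans; >⇒∤; *-cancelˡ-∣)
open import Data.Nat.Primality using (Prime; euclidsLemma; prime⇒nonZero; prime⇒nonTrivial)
open import Data.Nat.Tactic.RingSolver using (solve-∀)
open import Data.Sum using (inj₁; inj₂)
open import Algebra.Properties.CommutativeSemigroup *-commutativeSemigroup
  using (x∙yz≈y∙xz)
open Polynomials using (monicNull⇒∣!; repeatedResidues-monicNull)

^-monoʳ-∣ : ∀ p {m n} → m ≤ n → p ^ m ∣ p ^ n
^-monoʳ-∣ p {m} m≤n with m≤n⇒∃[o]m+o≡n m≤n
... | o , refl = divides (p ^ o) (trans (^-distribˡ-+-* p m o) (*-comm (p ^ m) (p ^ o)))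

module FactorialValuation {p : ℕ} (p-prime : Prime p) where
  instance
    p-nonZero : NonZero p
    p-nonZero = prime⇒nonZero p-prime
    p-nonTrivial : NonTrivial p
    p-nonTrivial = prime⇒nonTrivial p-prime

  ∤m∤n⇒∤m*n : ∀ {m n} → p ∤ m → p ∤ n → p ∤ m * n
  ∤m∤n⇒∤m*n {m} {n} p∤m p∤n p∣mn with euclidsLemma m n p-prime p∣mn
  ... | inj₁ p∣m = p∤m p∣m
  ... | inj₂ p∣n = p∤n p∣n

  ∤-between-multiples : ∀ q {m} → q * p < m → m < suc q * p → p ∤ m
  ∤-between-multiples q qp<m m<[1+q]p (divides j refl) =
    <⇒≱ (*-cancelʳ-< p q j qp<m) (s≤s⁻¹ (*-cancelʳ-< p j (suc q) m<[1+q]p))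

  record FactorialSplit (n : ℕ) : Set where
    constructor split
    field
      exponent cofactor  : ℕ
      n!≡                : n ! ≡ p ^ exponent * cofactor
      p∤cofactor         : p ∤ cofactor
      exponent*p≤n       : exponent * p ≤ n
      n<[1+exponent]*p   : n < suc exponent * p

  factorialSplit : ∀ n → n < p * p → FactorialSplit n
  factorialSplit zero    _ = split 0 1 refl (>⇒∤ (nonTrivial⇒n>1 p)) z≤n (m<n+m 0 (>-nonZero⁻¹ p))
  factorialSplit (suc n) 1+n<p*p with factorialSplit n (<⇒≤ 1+n<p*p)
  ... | split q u n!≡ p∤u q*p≤n n<[1+q]*p with m≤n⇒m<n∨m≡n n<[1+q]*p
  ... | inj₁ 1+n<[1+q]*p =
    split q (suc n * u) (trans (cong (suc n *_) n!≡) (x∙yz≈y∙xz (suc n) (p ^ q) u))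
      (∤m∤n⇒∤m*n (∤-between-multiples q (s≤s q*p≤n) 1+n<[1+q]*p) p∤u)
      (≤-trans q*p≤n (n≤1+n n)) 1+n<[1+q]*p
  ... | inj₂ 1+n≡[1+q]*p =
    split (suc q) (suc q * u) (trans (cong₂ _*_ 1+n≡[1+q]*p n!≡) (regroup (suc q) p (p ^ q) u))
      (∤m∤n⇒∤m*n (>⇒∤ 1+q<p) p∤u)
      (≤-reflexive (sym 1+n≡[1+q]*p))
      (subst (_< suc (suc q) * p) (sym 1+n≡[1+q]*p) (m<n+m (suc q * p) (>-nonZero⁻¹ p)))
    where
    1+q<p : suc q < p
    1+q<p = *-cancelʳ-< p (suc q) p (subst (_< p * p) 1+n≡[1+q]*p 1+n<p*p)
    regroup : ∀ a p P u → a * p * (P * u) ≡ p * P * (a * u)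
    regroup = solve-∀

  p^d∤n! : ∀ {d n} → d ≤ p → n < p * d → p ^ d ∤ n !
  p^d∤n! {d} {n} d≤p n<p*d p^d∣n! with factorialSplit n (<-≤-trans n<p*d (*-monoʳ-≤ p d≤p))
  ... | split q u n!≡ p∤u q*p≤n _ = p∤u (*-cancelˡ-∣ (p ^ q) {{m^n≢0 p q}} p^q*p∣p^q*u)
    where
    q<d : q < d
    q<d = *-cancelʳ-< p q d (≤-<-trans q*p≤n (subst (n <_) (*-comm p d) n<p*d))
    p^q*p∣p^q*u : p ^ q * p ∣ p ^ q * u
    p^q*p∣p^q*u = ∣-trans (subst (_∣ p ^ d) (*-comm p (p ^ q)) (^-monoʳ-∣ p q<d))
                          (subst (p ^ d ∣_) n!≡ p^d∣n!)

mainTheorem15 : ∀ (p d : ℕ) → Prime p → 2 ≤ d → d ≤ p → ω₁≡ (p ^ d) (p * d)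
mainTheorem15 p d p-prime 2≤d d≤p = 1≤p*d , repeatedResidues-monicNull p d , minimal
  where
  open FactorialValuation p-prime
  1≤p*d : 1 ≤ p * d
  1≤p*d = *-mono-≤ (>-nonZero⁻¹ p) (≤-trans (n≤1+n 1) 2≤d)
  minimal : ∀ n → 1 ≤ n → HasMonicNull (p ^ d) n → p * d ≤ n
  minimal n _ monicNull = ≮⇒≥ (λ n<p*d → p^d∤n! d≤p n<p*d (monicNull⇒∣! monicNull))
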